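{- Let $t$ and $k$ be positive integers and let $\ell_1, \ldots, \ell_m$ be positive integers such that for each $i$ there exists an $\ell_i t \times t$ Roman-$k$ design. Then for any non-negative integers $c_1, \ldots, c_m$ (not all zero), there exists an $n \times t$ Roman-$k$ design with $n = c_1\ell_1 + \cdots + c_m \ell_m$ rows.
   Context: A crossover design with $n$ subjects, $t$ treatments and $p$ periods is an $n \times p$ array $D$ whose entries are treatments, $D_{ij}$ being the treatment received by subject $i$ in period $j$. Here we only consider designs with $p = t$ that are uniform: each treatment occurs exactly once in each row, and each treatment occurs the same number of times (namely $n/t$) in each column. For an ordered pair $(x,y)$ of distinct treatments and $1 \le d \le t-1$, let $o_d(x,y)$ be the number of times, counted over all rows, that treatment $y$ occurs exactly $d$ periods after treatment $x$ in the same row. Such a design is Roman-$k$ if $o_d(x,y) \le n/t$ for all ordered pairs of distinct treatments $(x,y)$ and all $d$ with $1 \le d \le k$. An "$\ell t \times t$ design" is such a design with $\ell t$ rows and $t$ treatments and periods. -}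

module Defs where

open import Data.Nat using (ℕ; zero; suc; _+_; _*_; _≤_)
open import Data.Fin using (Fin; zero; suc; toℕ)
open import Data.Fin.Properties using () renaming (_≟_ to _≟ᶠ_)
open import Data.Bool using (Bool; true; false; _∧_; if_then_else_)
open import Relation.Nullary.Decidable using (⌊_⌋)
import Data.Nat.Properties as ℕP
open import Relation.Binary.PropositionalEquality using (_≡_; _≢_)

sumFin : ∀ {n} → (Fin n → ℕ) → ℕ
sumFin {zero}  f = 0
sumFin {suc n} f = f zero + sumFin (λ i → f (suc i))

[_] : Bool → ℕ
[ b ] = if b then 1 else 0

-- A design with n subjects (rows), t periods (columns) and t treatments:
-- D i j is the treatment received by subject i in period j.
Design : ℕ → ℕ → Set
Design n t = Fin n → Fin t → Fin t

rowCount : ∀ {n t} → Design n t → Fin n → Fin t → ℕ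
rowCount D i x = sumFin (λ j → [ ⌊ D i j ≟ᶠ x ⌋ ])

colCount : ∀ {n t} → Design n t → Fin t → Fin t → ℕ
colCount D j x = sumFin (λ i → [ ⌊ D i j ≟ᶠ x ⌋ ])

occ : ∀ {n t} → Design n t → ℕ → Fin t → Fin t → ℕ
occ D d x y =
  sumFin (λ i → sumFin (λ j → sumFin (λ j' →
    [ ⌊ toℕ j' ℕP.≟ toℕ j + d ⌋ ∧ ⌊ D i j ≟ᶠ x ⌋ ∧ ⌊ D i j' ≟ᶠ y ⌋ ])))

Uniform : ∀ ℓ t → Design (ℓ * t) t → Set
Uniform ℓ t D =
  (∀ i x → rowCount D i x ≡ 1) × (∀ j x → colCount D j x ≡ ℓ)
  where open import Data.Product using (_×_)

RomanK : ∀ ℓ t → ℕ → Design (ℓ * t) t → Set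
RomanK ℓ t k D = ∀ (x y : Fin t) → x ≢ y → ∀ d → 1 ≤ d → d ≤ k → occ D d x y ≤ ℓ

RomanDesign : ℕ → ℕ → ℕ → Set
RomanDesign ℓ t k = Σ (Design (ℓ * t) t) (λ D → Uniform ℓ t D × RomanK ℓ t k D)
  where open import Data.Product using (Σ; _×_)

-- Stacking an ℓ₁t × t design on top of an ℓ₂t × t design keeps every row a
-- permutation, adds the column counts (ℓ₁ + ℓ₂) and adds each o_d(x,y), which
-- therefore stays below ℓ₁ + ℓ₂. Hence Roman-k designs are closed under
-- stacking, and c₁ copies of the first design, ..., c_m copies of the last
-- one give the required design.
module Submission where

open import Defs
open import Data.Bool using (_∧_)
open import Data.Fin using (Fin; zero; suc; toℕ; _↑ˡ_; _↑ʳ_; splitAt)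
open import Data.Fin.Properties using (splitAt-↑ˡ; splitAt-↑ʳ) renaming (_≟_ to _≟ᶠ_)
open import Data.Nat using (ℕ; zero; suc; _+_; _*_; _≤_; z≤n)
open import Data.Nat.Properties using (+-assoc; +-mono-≤; *-distribʳ-+) renaming (_≟_ to _≟ⁿ_)
open import Data.Product using (∃; Σ; _×_; _,_)
open import Data.Sum using (inj₁; inj₂; [_,_]′)
open import Relation.Nullary.Decidable using (⌊_⌋)
open import Relation.Binary.PropositionalEquality
  using (_≡_; _≢_; refl; cong; cong₂; sym; trans; subst)

sumFin-cong : ∀ {n} {f g : Fin n → ℕ} → (∀ i → f i ≡ g i) → sumFin f ≡ sumFin g
sumFin-cong {zero}  f≗g = refl
sumFin-cong {suc n} f≗g = cong₂ _+_ (f≗g zero) (sumFin-cong (λ i → f≗g (suc i)))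

sumFin-+ : ∀ m n (f : Fin (m + n) → ℕ) →
           sumFin f ≡ sumFin (λ i → f (i ↑ˡ n)) + sumFin (λ i → f (m ↑ʳ i))
sumFin-+ zero    n f = refl
sumFin-+ (suc m) n f =
  trans (cong (f zero +_) (sumFin-+ m n (λ i → f (suc i))))
        (sym (+-assoc (f zero) _ _))

module _ {t : ℕ} where

  -- Uniform and RomanK with the number of rows decoupled from the column
  -- multiplicity ℓ; at N = ℓ * t they are Uniform ℓ t and RomanK ℓ t k.
  IsUniform : ∀ {N} → ℕ → Design N t → Set
  IsUniform ℓ D = (∀ i x → rowCount D i x ≡ 1) × (∀ j x → colCount D j x ≡ ℓ)

  IsRomanK : ∀ {N} → ℕ → ℕ → Design N t → Set
  IsRomanK ℓ k D = ∀ (x y : Fin t) → x ≢ y → ∀ d → 1 ≤ d → d ≤ k → occ D d x y ≤ ℓ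

  _⊕_ : ∀ {m n} → Design m t → Design n t → Design (m + n) t
  _⊕_ {m} D E i = [ D , E ]′ (splitAt m i)

  sumFin-rows-⊕ : ∀ {m n} (D : Design m t) (E : Design n t) (F : (Fin t → Fin t) → ℕ) →
                  sumFin (λ i → F ((D ⊕ E) i)) ≡ sumFin (λ i → F (D i)) + sumFin (λ i → F (E i))
  sumFin-rows-⊕ {m} {n} D E F =
    trans (sumFin-+ m n (λ i → F ((D ⊕ E) i)))
          (cong₂ _+_ (sumFin-cong (λ i → cong (λ s → F ([ D , E ]′ s)) (splitAt-↑ˡ m i n)))
                     (sumFin-cong (λ i → cong (λ s → F ([ D , E ]′ s)) (splitAt-↑ʳ m n i))))

  rowCount-⊕ : ∀ {m n} (D : Design m t) (E : Design n t) →
               (∀ i x → rowCount D i x ≡ 1) → (∀ i x → rowCount E i x ≡ 1) →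
               ∀ i x → rowCount (D ⊕ E) i x ≡ 1
  rowCount-⊕ {m} D E rowD rowE i x with splitAt m i
  ... | inj₁ i₁ = rowD i₁ x
  ... | inj₂ i₂ = rowE i₂ x

  colCount-⊕ : ∀ {m n} (D : Design m t) (E : Design n t) j x →
               colCount (D ⊕ E) j x ≡ colCount D j x + colCount E j x
  colCount-⊕ D E j x = sumFin-rows-⊕ D E (λ row → [ ⌊ row j ≟ᶠ x ⌋ ])

  occ-⊕ : ∀ {m n} (D : Design m t) (E : Design n t) d x y →
          occ (D ⊕ E) d x y ≡ occ D d x y + occ E d x y
  occ-⊕ D E d x y = sumFin-rows-⊕ D E (λ row → sumFin (λ j → sumFin (λ j' →
    [ ⌊ toℕ j' ≟ⁿ toℕ j + d ⌋ ∧ ⌊ row j ≟ᶠ x ⌋ ∧ ⌊ row j' ≟ᶠ y ⌋ ])))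

  ⊕-isUniform : ∀ {m n a b} {D : Design m t} {E : Design n t} →
                IsUniform a D → IsUniform b E → IsUniform (a + b) (D ⊕ E)
  ⊕-isUniform {D = D} {E} (rowD , colD) (rowE , colE) =
    rowCount-⊕ D E rowD rowE ,
    λ j x → trans (colCount-⊕ D E j x) (cong₂ _+_ (colD j x) (colE j x))

  ⊕-isRomanK : ∀ {m n a b k} {D : Design m t} {E : Design n t} →
               IsRomanK a k D → IsRomanK b k E → IsRomanK (a + b) k (D ⊕ E)
  ⊕-isRomanK {D = D} {E} romD romE x y x≢y d 1≤d d≤k =
    subst (_≤ _) (sym (occ-⊕ D E d x y))
          (+-mono-≤ (romD x y x≢y d 1≤d d≤k) (romE x y x≢y d 1≤d d≤k))

module _ {t k : ℕ} where

  romanDesign-+ : ∀ {a b} → RomanDesign a t k → RomanDesign b t k → RomanDesign (a + b) t k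
  romanDesign-+ {a} {b} (D , uniD , romD) (E , uniE , romE) =
    subst (λ N → Σ (Design N t) (λ F → IsUniform (a + b) F × IsRomanK (a + b) k F))
          (sym (*-distribʳ-+ t a b))
          (D ⊕ E , ⊕-isUniform uniD uniE , ⊕-isRomanK {D = D} {E} romD romE)

  romanDesign-0 : RomanDesign 0 t k
  romanDesign-0 = (λ ()) , ((λ ()) , (λ j x → refl)) , (λ x y x≢y d 1≤d d≤k → z≤n)

  romanDesign-* : ∀ c {ℓ} → RomanDesign ℓ t k → RomanDesign (c * ℓ) t k
  romanDesign-* zero    R = romanDesign-0
  romanDesign-* (suc c) R = romanDesign-+ R (romanDesign-* c R)

  romanDesign-sumFin : ∀ {m} (ℓ : Fin m → ℕ) → (∀ i → RomanDesign (ℓ i) t k) →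
                       RomanDesign (sumFin ℓ) t k
  romanDesign-sumFin {zero}  ℓ R = romanDesign-0
  romanDesign-sumFin {suc m} ℓ R =
    romanDesign-+ (R zero) (romanDesign-sumFin (λ i → ℓ (suc i)) (λ i → R (suc i)))

-- Positivity of t, k and the ℓ i, and c ≢ 0, only exclude the empty design,
-- which is (vacuously) a Roman-k design as well.
lemma2 : (t k : ℕ) → 1 ≤ t → 1 ≤ k → (m : ℕ) → (ℓ : Fin m → ℕ) → (∀ i → 1 ≤ ℓ i) →
         (∀ i → RomanDesign (ℓ i) t k) →
         (c : Fin m → ℕ) → (∃ λ i → c i ≢ 0) →
         RomanDesign (sumFin (λ i → c i * ℓ i)) t k
lemma2 t k _ _ m ℓ _ R c _ =
  romanDesign-sumFin (λ i → c i * ℓ i) (λ i → romanDesign-* (c i) (R i))
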